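{- Let $I$ be a concrete system and $\tilde I$ its abstraction with abstraction maps $h,h_A$ (as in the context). Let $\tilde\pi=\tilde s_1\to\dots\to\tilde s_n$ be a path in $\tilde I$. If there exists a concrete path $\pi=s_1\to\dots\to s_n$ corresponding to $\tilde\pi$ and $s_1\in st_1\subseteq h^{ -1}(\tilde s_1)$, then $(\tilde\pi,st_1)\Rightarrow^*(\tilde s_n,st_n)$ for some $st_n$ with $\emptyset\subset st_n\subseteq S$.
   Context: Concrete system $I$: agents $\Omega$; each agent $i$ has a finite set $\Phi_i$ of Boolean propositions (pairwise disjoint, $\Phi=\bigcup\Phi_i$); local states $L_i$ = valuations of $\Phi_i$; global states $S$ = tuples of local states, $l_i(s)$ the $i$-component, $L_a(st)=\{l_a(s):s\in st\}$; initial states $S_0$. Finitely many actions $\alpha:\varepsilon\leftarrow\ell$, each owned by an agent, with guard $\ell$ a propositional formula over $\Phi$ and effect $\varepsilon$ a set of signed propositions $\pm p$. $\Theta_\alpha(st)=\{s[p\mapsto\top\mid+p\in\varepsilon][p\mapsto\bot\mid-p\in\varepsilon]: s\in st, s\models\ell\}$; $s\xrightarrow{\alpha}s'$ iff $\Theta_\alpha(\{s\})=\{s'\}$. Reachable states: reachable from $S_0$ by finitely many transitions; $s\sim_a s'$ iff $l_a(s)=l_a(s')$ and both are reachable. Abstraction: for $\tilde\Phi\subseteq\Phi$, local states are identified when they agree on $\tilde\Phi\cap\Phi_i$, giving abstract states $\tilde S$ and $h(s)=(h_i(l_i(s)))_i$. Actions are equivalent iff same owner, same effects restricted to $\tilde\Phi$,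 and equivalent guards after existentially quantifying $\Phi\setminus\tilde\Phi$ ($\exists x.f=f[\bot/x]\vee f[\top/x]$); $h_A(\alpha)=[\alpha]$ is the abstract action with the restricted effect and quantified guard; abstract transitions are defined from these as in the concrete case; $\tilde S_0=h(S_0)$; abstract reachability and $\tilde s\sim_a\tilde s'$ are defined analogously. A path (abstract or concrete) is a finite sequence of states where each step is either a temporal transition $\xrightarrow{\alpha}$ or an epistemic step $\sim_a$; a temporal path uses only temporal steps; a single state is the empty path; $x\,\|\,\pi$ denotes prefixing a step $x$ to a path $\pi$. A concrete path $s_1\to\dots\to s_n$ corresponds to the abstract path $\tilde s_1\to\dots\to\tilde s_n$ if $h(s_i)=\tilde s_i$ for all $i$; each abstract temporal step $\tilde s_i\xrightarrow{\tilde\alpha}\tilde s_{i+1}$ is matched by a concrete step $s_i\xrightarrow{\alpha}s_{i+1}$ with $h_A(\alpha)=\tilde\alpha$; and each abstract epistemic step $\tilde s_i\sim_a\tilde s_{i+1}$ is matched by $s_i\sim_a s_{i+1}$ with $s_{i+1}$ reachable in $I$. Rules on pairs (abstract path, set of concrete states): TemporalCheck: $(\tilde s\xrightarrow{\tilde\alpha}\tilde s'\,\|\,\pi,\ st)\Rightarrow_t(\pi,\ \bigcup_{\alpha\in h_A^{ -1}(\tilde\alpha)}\Theta_\alpha(st)\cap h^{ -1}(\tilde s'))$. EpistemicCheck: if $\pi'=\tilde s'_0\xrightarrow{\tilde\alpha'_1}\dots\xrightarrow{\tilde\alpha'_m}\tilde s'$ is a temporal abstract path with $\tilde s'_0\in\tilde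 S_0$ (a witness of reachability of $\tilde s'$), $(\pi',S_0\cap h^{ -1}(\tilde s'_0))\Rightarrow_t^*(\tilde s',st')$, and $\hat{st}=\{s\in st': l_a(s)\in L_a(st)\}$, then $(\tilde s\sim_a\tilde s'\,\|\,\pi,\ st)\Rightarrow_e(\pi,\hat{st})$. $\Rightarrow_t^*$ is a finite sequence of $\Rightarrow_t$ steps; $\Rightarrow^*$ a finite sequence of $\Rightarrow_t$ or $\Rightarrow_e$ steps. -}

module Defs where

open import Level using (0ℓ)
open import Data.Nat using (ℕ)
open import Data.Bool using (Bool; true; false; if_then_else_; _∧_; _∨_; not)
open import Data.Fin using (Fin; _≟_)
open import Data.Vec using (Vec; lookup; tabulate)
open import Data.List using (List; []; _∷_; foldr; allFin)
open import Data.List.Membership.Propositional using (_∈_)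
open import Data.Product using (_×_; _,_; ∃; ∃-syntax; Σ)
open import Relation.Nullary using (does)
open import Relation.Binary.PropositionalEquality using (_≡_)
open import Relation.Binary.Construct.Closure.ReflexiveTransitive using (Star)
open import Function.Bundles using (_⇔_)

data Form (n : ℕ) : Set where
  var : Fin n → Form n
  tt ff : Form n
  neg : Form n → Form n
  and or : Form n → Form n → Form n

State : ℕ → Set
State n = Vec Bool n

eval : ∀ {n} → Form n → State n → Bool
eval (var p) s = lookup s p
eval tt s = true
eval ff s = false
eval (neg f) s = not (eval f s)
eval (and f g) s = eval f s ∧ eval g s
eval (or f g) s = eval f s ∨ eval g s

substF : ∀ {n} → Fin n → Bool → Form n → Form n
substF x b (var p) = if does (p ≟ x) then (if b then tt else ff) else var p
substF x b tt = tt
substF x b ff = ff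
substF x b (neg f) = neg (substF x b f)
substF x b (and f g) = and (substF x b f) (substF x b g)
substF x b (or f g) = or (substF x b f) (substF x b g)

exQ : ∀ {n} → Fin n → Form n → Form n
exQ x f = or (substF x false f) (substF x true f)

-- Effects: a list of signed propositions; (p , true) is +p, (p , false) is -p.

Effect : ℕ → Set
Effect n = List (Fin n × Bool)

hasEff : ∀ {n} → Effect n → Fin n → Bool → Bool
hasEff [] p b = false
hasEff ((q , c) ∷ ε) p b =
  (does (q ≟ p) ∧ (if c then b else not b)) ∨ hasEff ε p b

applyEff : ∀ {n} → Effect n → State n → State n
applyEff ε s = tabulate λ p →
  if hasEff ε p false then false else (if hasEff ε p true then true else lookup s p)

-- Concrete systems.  Agents are Fin m, propositions are Fin n, and
-- own p is the agent i with p ∈ Φ_i (so the Φ_i are pairwise disjoint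
-- and cover Φ).  Actions are Fin k.

record System : Set₁ where
  field
    m n k  : ℕ
    own    : Fin n → Fin m
    S₀     : State n → Set
    actOwn : Fin k → Fin m
    guard  : Fin k → Form n
    eff    : Fin k → Effect n

open System public

StateSet : System → Set₁
StateSet I = State (n I) → Set

sameLocal : (I : System) → Fin (m I) → State (n I) → State (n I) → Set
sameLocal I a s s' = ∀ p → own I p ≡ a → lookup s p ≡ lookup s' p

ΘG : (I : System) → Form (n I) → Effect (n I) → StateSet I → StateSet I
ΘG I g ε st t = ∃[ s ] (st s × eval g s ≡ true × t ≡ applyEff ε s)

Θ : (I : System) → Fin (k I) → StateSet I → StateSet I
Θ I α = ΘG I (guard I α) (eff I α)

Step : (I : System) → Fin (k I) → State (n I) → State (n I) → Set
Step I α s s' = ∀ t → Θ I α (λ u → u ≡ s) t ⇔ (t ≡ s')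

data Reach (I : System) : State (n I) → Set where
  init : ∀ {s} → S₀ I s → Reach I s
  step : ∀ {s s' α} → Reach I s → Step I α s s' → Reach I s'

Epi : (I : System) → Fin (m I) → State (n I) → State (n I) → Set
Epi I a s s' = sameLocal I a s s' × Reach I s × Reach I s'

-- Paths (used both for concrete and abstract paths).  Abstract actions
-- [α] are represented by a representative concrete action α.

data Label (I : System) : Set where
  tmp : Fin (k I) → Label I
  epi : Fin (m I) → Label I

data Path (I : System) : Set where
  end  : State (n I) → Path I
  _⟶[_]_ : State (n I) → Label I → Path I → Path I

first : ∀ {I} → Path I → State (n I)
first (end s) = s
first (s ⟶[ _ ] _) = s

final : ∀ {I} → Path I → State (n I)
final (end s) = s
final (_ ⟶[ _ ] π) = final π

-- Abstraction w.r.t. Φ̃ = { p | keep p ≡ true }.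
-- Abstract states are represented as valuations in which every
-- proposition outside Φ̃ is false (canonical representative of the
-- class of states agreeing on Φ̃).

module _ (I : System) (keep : Fin (n I) → Bool) where

  h : State (n I) → State (n I)
  h s = tabulate λ p → if keep p then lookup s p else false

  quantGuard : Form (n I) → Form (n I)
  quantGuard g = foldr (λ x f → if keep x then f else exQ x f) g (allFin (n I))

  restrictEff : Effect (n I) → Effect (n I)
  restrictEff [] = []
  restrictEff ((p , b) ∷ ε) = if keep p then (p , b) ∷ restrictEff ε else restrictEff ε

  -- α and β are equivalent, i.e. h_A(α) = h_A(β)
  ActEquiv : Fin (k I) → Fin (k I) → Set
  ActEquiv α β =
    actOwn I α ≡ actOwn I β
    × (∀ e → (e ∈ restrictEff (eff I α)) ⇔ (e ∈ restrictEff (eff I β)))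
    × (∀ s → eval (quantGuard (guard I α)) s ≡ eval (quantGuard (guard I β)) s)

  AΘ : Fin (k I) → StateSet I → StateSet I
  AΘ α = ΘG I (quantGuard (guard I α)) (restrictEff (eff I α))

  AStep : Fin (k I) → State (n I) → State (n I) → Set
  AStep α s s' = ∀ t → AΘ α (λ u → u ≡ s) t ⇔ (t ≡ s')

  AInit : StateSet I
  AInit s̃ = ∃[ s ] (S₀ I s × h s ≡ s̃)

  data AReach : State (n I) → Set where
    ainit : ∀ {s} → AInit s → AReach s
    astep : ∀ {s s' α} → AReach s → AStep α s s' → AReach s'

  ASameLocal : Fin (m I) → State (n I) → State (n I) → Set
  ASameLocal a s s' = ∀ p → own I p ≡ a → keep p ≡ true → lookup s p ≡ lookup s' p

  AEpi : Fin (m I) → State (n I) → State (n I) → Set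
  AEpi a s s' = ASameLocal a s s' × AReach s × AReach s'

  APath : Path I → Set
  APath (end s) = ⊤'
    where open import Data.Unit using () renaming (⊤ to ⊤')
  APath (s ⟶[ tmp α ] π) = AStep α s (first π) × APath π
  APath (s ⟶[ epi a ] π) = AEpi a s (first π) × APath π

  ATemporal : Path I → Set
  ATemporal (end s) = ⊤'
    where open import Data.Unit using () renaming (⊤ to ⊤')
  ATemporal (s ⟶[ tmp α ] π) = AStep α s (first π) × ATemporal π
  ATemporal (s ⟶[ epi a ] π) = ⊥'
    where open import Data.Empty using () renaming (⊥ to ⊥')

  data Corr : Path I → Path I → Set where
    c-end : ∀ {s s̃} → h s ≡ s̃ → Corr (end s) (end s̃)
    c-tmp : ∀ {s s̃ α α̃ π π̃} → h s ≡ s̃ → ActEquiv α α̃ →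
            Step I α s (first π) → Corr π π̃ →
            Corr (s ⟶[ tmp α ] π) (s̃ ⟶[ tmp α̃ ] π̃)
    c-epi : ∀ {s s̃ a π π̃} → h s ≡ s̃ →
            Epi I a s (first π) → Reach I (first π) → Corr π π̃ →
            Corr (s ⟶[ epi a ] π) (s̃ ⟶[ epi a ] π̃)

  Config : Set₁
  Config = Path I × StateSet I

  data _⇒t_ : Config → Config → Set₁ where
    temporalCheck : ∀ {s̃ α̃ π st} →
      ((s̃ ⟶[ tmp α̃ ] π) , st) ⇒t
      (π , λ t → ∃[ α ] (ActEquiv α α̃ × Θ I α st t) × h t ≡ first π)

  _⇒t*_ : Config → Config → Set₁
  _⇒t*_ = Star _⇒t_

  data _⇒_ : Config → Config → Set₁ where
    tstep : ∀ {c c'} → c ⇒t c' → c ⇒ c'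
    epistemicCheck : ∀ {s̃ a π st} (π' : Path I) (st' : StateSet I) →
      ATemporal π' → AInit (first π') →
      (π' , (λ s → S₀ I s × h s ≡ first π')) ⇒t* (end (first π) , st') →
      ((s̃ ⟶[ epi a ] π) , st) ⇒
      (π , λ s → st' s × ∃[ s₀ ] (st s₀ × sameLocal I a s s₀))

  _⇒*_ : Config → Config → Set₁
  _⇒*_ = Star _⇒_

-- The proof follows the concrete path step by step, keeping the invariant
-- that the current concrete state lies in the current set of the check.
--   * A temporal step s →α s' survives TemporalCheck: s' ∈ Θ_α(st), α is
--     equivalent to the abstract label, and h(s') is the next abstract state.
--   * An epistemic step s ∼_a s' survives EpistemicCheck once we exhibit a
--     witness of abstract reachability for h(s') whose temporal check still
--     contains s'.  Such a witness is the image under h of a concrete run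
--     s₀ → … → s' from an initial state; that it is an abstract temporal path
--     rests on two facts: quantifying out propositions preserves the truth of
--     a guard at h(s), and h commutes with the application of effects.
module Submission where

open import Defs
open import Data.Nat using (ℕ)
open import Data.Fin using (Fin; _≟_)
open import Data.Bool using (Bool; true; false; if_then_else_; _∧_; _∨_; not)
open import Data.Bool.Properties using (∨-zeroʳ; ∧-zeroʳ)
open import Data.Product using (_×_; _,_; ∃-syntax)
open import Data.Sum using (_⊎_; inj₁; inj₂)
open import Data.Empty using (⊥-elim)
open import Data.Unit using (tt)
open import Data.List using (List; []; _∷_; foldr; allFin)
open import Data.List.Membership.Propositional using (_∈_)
open import Data.List.Membership.Propositional.Properties using (∈-allFin)
open import Data.List.Relation.Unary.Any using (here; there)
open import Data.Vec using (lookup; _[_]≔_)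
open import Data.Vec.Properties using (lookup∘update; lookup∘update′; lookup∘tabulate; tabulate-cong)
open import Relation.Nullary using (yes; no)
open import Relation.Binary.PropositionalEquality using (_≡_; refl; sym; trans; cong; cong₂; subst)
open import Relation.Binary.Construct.Closure.ReflexiveTransitive using (Star; ε; _◅_; _◅◅_)
open import Function.Bundles using (mk⇔; Equivalence)

eval-cong : ∀ {n} (f : Form n) {u v : State n} →
  (∀ p → lookup u p ≡ lookup v p) → eval f u ≡ eval f v
eval-cong (var p) same = same p
eval-cong tt same = refl
eval-cong ff same = refl
eval-cong (neg f) same = cong not (eval-cong f same)
eval-cong (and f g) same = cong₂ _∧_ (eval-cong f same) (eval-cong g same)
eval-cong (or f g) same = cong₂ _∨_ (eval-cong f same) (eval-cong g same)

eval-substF : ∀ {n} (x : Fin n) (b : Bool) (f : Form n) (s : State n) →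
  eval (substF x b f) s ≡ eval f (s [ x ]≔ b)
eval-substF x b (var p) s with p ≟ x
... | yes refl = trans (constant b) (sym (lookup∘update p s b))
  where
  constant : ∀ c → eval (if c then tt else ff) s ≡ c
  constant true = refl
  constant false = refl
... | no p≢x = sym (lookup∘update′ p≢x s b)
eval-substF x b tt s = refl
eval-substF x b ff s = refl
eval-substF x b (neg f) s = cong not (eval-substF x b f s)
eval-substF x b (and f g) s = cong₂ _∧_ (eval-substF x b f s) (eval-substF x b g s)
eval-substF x b (or f g) s = cong₂ _∨_ (eval-substF x b f s) (eval-substF x b g s)

exQ-intro : ∀ {n} (x : Fin n) (f : Form n) (s : State n) (b : Bool) →
  eval f (s [ x ]≔ b) ≡ true → eval (exQ x f) s ≡ true
exQ-intro x f s b holds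
  rewrite eval-substF x false f s | eval-substF x true f s = witness b holds
  where
  witness : ∀ c → eval f (s [ x ]≔ c) ≡ true →
    eval f (s [ x ]≔ false) ∨ eval f (s [ x ]≔ true) ≡ true
  witness false holds′ rewrite holds′ = refl
  witness true holds′ rewrite holds′ = ∨-zeroʳ _

module Quantification {n : ℕ} (keep : Fin n → Bool) where

  -- Quantify out the non-kept propositions of L; quantGuard is the case L = allFin n.
  quantifyOut : List (Fin n) → Form n → Form n
  quantifyOut L g = foldr (λ x f → if keep x then f else exQ x f) g L

  AgreeExcept : List (Fin n) → State n → State n → Set
  AgreeExcept L u v = ∀ p → lookup u p ≡ lookup v p ⊎ (p ∈ L × keep p ≡ false)

  agree-kept : ∀ {x L u v} → keep x ≡ true → AgreeExcept (x ∷ L) u v → AgreeExcept L u v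
  agree-kept {x} kept agree p with agree p
  ... | inj₁ same = inj₁ same
  ... | inj₂ (here refl , dropped) with trans (sym kept) dropped
  ...   | ()
  agree-kept kept agree p | inj₂ (there p∈L , dropped) = inj₂ (p∈L , dropped)

  agree-fix : ∀ {x L u v} → AgreeExcept (x ∷ L) u v → AgreeExcept L (u [ x ]≔ lookup v x) v
  agree-fix {x} {u = u} {v} agree p with p ≟ x
  ... | yes refl = inj₁ (lookup∘update p u (lookup v p))
  ... | no p≢x with agree p
  ...   | inj₁ same = inj₁ (trans (lookup∘update′ p≢x u (lookup v x)) same)
  ...   | inj₂ (here refl , _) = ⊥-elim (p≢x refl)
  ...   | inj₂ (there p∈L , dropped) = inj₂ (p∈L , dropped)

  agree-[] : ∀ {u v} → AgreeExcept [] u v → ∀ p → lookup u p ≡ lookup v p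
  agree-[] agree p with agree p
  ... | inj₁ same = same
  ... | inj₂ (() , _)

  quantifyOut-intro : ∀ L g {u v} → AgreeExcept L u v → eval g v ≡ true →
    eval (quantifyOut L g) u ≡ true
  quantifyOut-intro [] g {u} {v} agree holds = trans (eval-cong g (agree-[] {u} {v} agree)) holds
  quantifyOut-intro (x ∷ L) g {u} {v} agree holds with keep x in kept
  ... | true = quantifyOut-intro L g (agree-kept {x} {L} {u} {v} kept agree) holds
  ... | false = exQ-intro x (quantifyOut L g) u (lookup v x)
                  (quantifyOut-intro L g (agree-fix {x} {L} {u} {v} agree) holds)

module _ (I : System) (keep : Fin (n I) → Bool) where

  open Quantification keep

  St : Set
  St = State (n I)

  abs : St → St
  abs = h I keep

  lookup-abs : ∀ s p → lookup (abs s) p ≡ (if keep p then lookup s p else false)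
  lookup-abs s p = lookup∘tabulate (λ q → if keep q then lookup s q else false) p

  abs-agree : ∀ s → AgreeExcept (allFin (n I)) (abs s) s
  abs-agree s p rewrite lookup-abs s p with keep p
  ... | true = inj₁ refl
  ... | false = inj₂ (∈-allFin p , refl)

  guard-abstract : ∀ g s → eval g s ≡ true → eval (quantGuard I keep g) (abs s) ≡ true
  guard-abstract g s = quantifyOut-intro (allFin (n I)) g (abs-agree s)

  hasEff-restrict : ∀ es p b → hasEff (restrictEff I keep es) p b ≡ keep p ∧ hasEff es p b
  hasEff-restrict [] p b = sym (∧-zeroʳ (keep p))
  hasEff-restrict ((q , c) ∷ es) p b with keep q in kept
  ... | true with q ≟ p
  ...   | no _ = hasEff-restrict es p b
  ...   | yes refl rewrite hasEff-restrict es q b | kept = refl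
  hasEff-restrict ((q , c) ∷ es) p b | false with q ≟ p
  ...   | no _ = hasEff-restrict es p b
  ...   | yes refl rewrite hasEff-restrict es q b | kept = refl

  applyEff-restrict : ∀ es s → applyEff (restrictEff I keep es) (abs s) ≡ abs (applyEff es s)
  applyEff-restrict es s = tabulate-cong pointwise
    where
    concrete : Fin (n I) → Bool
    concrete p = if hasEff es p false then false else (if hasEff es p true then true else lookup s p)

    pointwise : ∀ p →
      (if hasEff (restrictEff I keep es) p false then false
       else (if hasEff (restrictEff I keep es) p true then true else lookup (abs s) p))
      ≡ (if keep p then lookup (applyEff es s) p else false)
    pointwise p rewrite hasEff-restrict es p false | hasEff-restrict es p true
                      | lookup-abs s p | lookup∘tabulate concrete p with keep p
    ... | true = refl
    ... | false = refl

  step-Θ : ∀ {α s s'} (st : StateSet I) → Step I α s s' → st s → Θ I α st s'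
  step-Θ {s' = s'} st transition s∈st with Equivalence.from (transition s') refl
  ... | s , refl , enabled , effect = s , s∈st , enabled , effect

  step-abstract : ∀ {α s s'} → Step I α s s' → AStep I keep α (abs s) (abs s')
  step-abstract {α} {s} {s'} transition t with Equivalence.from (transition s') refl
  ... | _ , refl , enabled , effect = mk⇔ to from
    where
    to : AΘ I keep α (λ u → u ≡ abs s) t → t ≡ abs s'
    to (_ , refl , _ , t≡) = trans t≡ (trans (applyEff-restrict (eff I α) s) (cong abs (sym effect)))
    from : t ≡ abs s' → AΘ I keep α (λ u → u ≡ abs s) t
    from t≡ = abs s , refl , guard-abstract (guard I α) s enabled ,
              trans t≡ (trans (cong abs effect) (sym (applyEff-restrict (eff I α) s)))

  -- Every action is equivalent to itself, so it may label its own abstract step.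
  ActEquiv-refl : ∀ α → ActEquiv I keep α α
  ActEquiv-refl α = refl , (λ _ → mk⇔ (λ x → x) (λ x → x)) , (λ _ → refl)

  afterTemporal : Fin (k I) → St → StateSet I → StateSet I
  afterTemporal α̃ s̃' st t = ∃[ α ] (ActEquiv I keep α α̃ × Θ I α st t) × abs t ≡ s̃'

  step-survives : ∀ {α α̃ s s' s̃'} (st : StateSet I) → Step I α s s' → ActEquiv I keep α α̃ →
    st s → abs s' ≡ s̃' → afterTemporal α̃ s̃' st s'
  step-survives st transition equiv s∈st image = _ , (equiv , step-Θ st transition s∈st) , image

  _⟶_ : St → St → Set
  s ⟶ s' = ∃[ α ] Step I α s s'

  reach⇒run : ∀ {s} → Reach I s → ∃[ s₀ ] (S₀ I s₀ × Star _⟶_ s₀ s)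
  reach⇒run (init initial) = _ , initial , ε
  reach⇒run (step reach transition) with reach⇒run reach
  ... | s₀ , initial , run = s₀ , initial , run ◅◅ ((_ , transition) ◅ ε)

  abstractRun : ∀ {s s'} → Star _⟶_ s s' → Path I
  abstractRun {s} ε = end (abs s)
  abstractRun {s} ((α , _) ◅ run) = abs s ⟶[ tmp α ] abstractRun run

  first-abstractRun : ∀ {s s'} (run : Star _⟶_ s s') → first (abstractRun run) ≡ abs s
  first-abstractRun ε = refl
  first-abstractRun (_ ◅ _) = refl

  abstractRun-temporal : ∀ {s s'} (run : Star _⟶_ s s') → ATemporal I keep (abstractRun run)
  abstractRun-temporal ε = tt
  abstractRun-temporal ((α , transition) ◅ run) =
    subst (AStep I keep α _) (sym (first-abstractRun run)) (step-abstract transition) ,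
    abstractRun-temporal run

  abstractRun-checks : ∀ {s s'} (run : Star _⟶_ s s') (st : StateSet I) → st s →
    ∃[ st' ] (_⇒t*_ I keep (abstractRun run , st) (end (abs s') , st') × st' s')
  abstractRun-checks ε st s∈st = st , ε , s∈st
  abstractRun-checks ((α , transition) ◅ run) st s∈st =
    let st' , checks , s'∈st' =
          abstractRun-checks run (afterTemporal α (first (abstractRun run)) st)
            (step-survives st transition (ActEquiv-refl α) s∈st (sym (first-abstractRun run)))
    in st' , temporalCheck ◅ checks , s'∈st'

  reachWitness : ∀ {s} → Reach I s →
    ∃[ π' ] ∃[ st' ] (ATemporal I keep π' × AInit I keep (first π') ×
      _⇒t*_ I keep (π' , (λ u → S₀ I u × abs u ≡ first π')) (end (abs s) , st') × st' s)
  reachWitness reach with reach⇒run reach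
  ... | s₀ , initial , run =
    let π' = abstractRun run
        s₀-image = sym (first-abstractRun run)
        st' , checks , s∈st' = abstractRun-checks run (λ u → S₀ I u × abs u ≡ first π') (initial , s₀-image)
    in π' , st' , abstractRun-temporal run , (s₀ , initial , s₀-image) , checks , s∈st'

  corr-first : ∀ {π π̃} → Corr I keep π π̃ → abs (first π) ≡ first π̃
  corr-first (c-end image) = image
  corr-first (c-tmp image _ _ _) = image
  corr-first (c-epi image _ _ _) = image

  corr-checks : ∀ {π π̃} → Corr I keep π π̃ → (st : StateSet I) → st (first π) →
    ∃[ stₙ ] (_⇒*_ I keep (π̃ , st) (end (final π̃) , stₙ) × ∃[ s ] stₙ s)
  corr-checks {end s} (c-end _) st s∈st = st , ε , s , s∈st
  corr-checks (c-tmp {π̃ = π̃} _ equiv transition corr) st s∈st =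
    let stₙ , checks , nonEmpty =
          corr-checks corr (afterTemporal _ (first π̃) st) (step-survives st transition equiv s∈st (corr-first corr))
    in stₙ , tstep temporalCheck ◅ checks , nonEmpty
  corr-checks (c-epi {s = s} {a = a} _ (sameL , _ , reach) _ corr) st s∈st =
    let π' , st' , temporal , initial , witness , s'∈st' = reachWitness reach
        stₙ , checks , nonEmpty =
          corr-checks corr (λ u → st' u × ∃[ s₀ ] (st s₀ × sameLocal I a u s₀))
            (s'∈st' , s , s∈st , λ p owned → sym (sameL p owned))
        witness′ = subst (λ s̃ → _⇒t*_ I keep (π' , _) (end s̃ , st')) (corr-first corr) witness
    in stₙ , epistemicCheck π' st' temporal initial witness′ ◅ checks , nonEmpty

proposition5 : (I : System) (keep : Fin (n I) → Bool)
    (π̃ : Path I) → APath I keep π̃ →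
    (π : Path I) → Corr I keep π π̃ →
    (st₁ : StateSet I) → st₁ (first π) → (∀ s → st₁ s → h I keep s ≡ first π̃) →
    ∃[ stₙ ] (_⇒*_ I keep (π̃ , st₁) (end (final π̃) , stₙ) × ∃[ s ] stₙ s)
proposition5 I keep _ _ _ corr st₁ s₁∈st₁ _ = corr-checks I keep corr st₁ s₁∈st₁
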